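{- For any permutation $\alpha\in S_n$, the number of back points of $\alpha$ plus the number of back points of $\alpha^{ -1}\zeta_n$ equals $2g(\alpha)$.
   Context: $\zeta_n\in S_n$ is the cycle $(1,2,\dots,n)$; permutations are composed right to left ($\alpha\beta(i)=\alpha(\beta(i))$); $z(\pi)$ is the number of cycles (fixed points included). The genus of $\alpha\in S_n$ is defined by $n+1-2g(\alpha)=z(\alpha)+z(\alpha^{ -1}\zeta_n)$. An element $i$ is a back point of a permutation $\pi$ if $\pi(i)<i$ and $\pi(i)$ is not the smallest element of its cycle of $\pi$. -}

module Defs where

open import Data.Nat using (ℕ; zero; suc)
open import Data.Fin using (Fin; zero; suc; toℕ; fromℕ; inject₁; _<_; _≤_)
open import Data.Fin.Properties using (_<?_; _≤?_)
open import Data.Fin.Permutation using (Permutation′; permutation; _⟨$⟩ʳ_; _∘ₚ_; flip)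
open import Data.List using (List; length; filter)
open import Data.List.Relation.Unary.All using (All)
open import Data.List.Relation.Unary.All.Properties using ()
open import Data.Bool using (Bool)
open import Data.Product using (_×_)
open import Relation.Nullary using (Dec; yes; no; ¬_)
open import Relation.Nullary.Decidable using (_×-dec_; ¬?)
open import Relation.Binary.PropositionalEquality using (_≡_; refl; cong)
open import Data.List.Relation.Unary.All using (all?)
open import Data.List using (upTo; map)
open import Data.Integer using (ℤ; +_; _-_)

-- Elements 1..n of the paper are represented by Fin n (0-indexed, order-preserving).

sucMod : ∀ {n} → Fin (suc n) → Fin (suc n)
sucMod {zero} zero = zero
sucMod {suc n} zero = suc zero
sucMod {suc n} (suc i) with sucMod {n} i
... | zero = zero
... | suc j = suc (suc j)

predMod : ∀ {n} → Fin (suc n) → Fin (suc n)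
predMod {n} zero = fromℕ n
predMod (suc i) = inject₁ i

private
  sucMod-fromℕ : ∀ n → sucMod (fromℕ n) ≡ zero
  sucMod-fromℕ zero = refl
  sucMod-fromℕ (suc n) rewrite sucMod-fromℕ n = refl

  sucMod-inject₁ : ∀ {n} (i : Fin n) → sucMod (inject₁ i) ≡ suc i
  sucMod-inject₁ {suc n} zero = refl
  sucMod-inject₁ {suc n} (suc i) rewrite sucMod-inject₁ i = refl

  sp : ∀ {n} (i : Fin (suc n)) → sucMod (predMod i) ≡ i
  sp {n} zero = sucMod-fromℕ n
  sp (suc i) = sucMod-inject₁ i

  ps : ∀ {n} (i : Fin (suc n)) → predMod (sucMod i) ≡ i
  ps {zero} zero = refl
  ps {suc n} zero = refl
  ps {suc n} (suc i) with sucMod {n} i | ps {n} i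
  ... | zero | eq = cong suc eq
  ... | suc j | eq = cong suc eq

-- the long cycle ζ = (1 2 … n) in S_n (here n = suc m)
ζ : ∀ n → Permutation′ (suc n)
ζ n = permutation sucMod predMod sp ps

iter : ∀ {n} → Permutation′ n → ℕ → Fin n → Fin n
iter π zero i = i
iter π (suc k) i = π ⟨$⟩ʳ iter π k i

-- i is the smallest element of its cycle of π:  i ≤ π^k(i) for all k < n
-- (the orbit of i is {π^k(i) | k < n}).
IsCycleMin : ∀ {n} → Permutation′ n → Fin n → Set
IsCycleMin {n} π i = All (λ k → i ≤ iter π k i) (upTo n)

isCycleMin? : ∀ {n} (π : Permutation′ n) (i : Fin n) → Dec (IsCycleMin π i)
isCycleMin? {n} π i = all? (λ k → i ≤? iter π k i) (upTo n)

allFinL : ∀ n → List (Fin n)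
allFinL zero = Data.List.[]
allFinL (suc n) = zero Data.List.∷ map suc (allFinL n)

-- z(π): number of cycles of π (fixed points included), counted as the
-- number of elements that are the minimum of their cycle.
z : ∀ {n} → Permutation′ n → ℕ
z π = length (filter (isCycleMin? π) (allFinL _))

IsBackPoint : ∀ {n} → Permutation′ n → Fin n → Set
IsBackPoint π i = (π ⟨$⟩ʳ i < i) × ¬ IsCycleMin π (π ⟨$⟩ʳ i)

isBackPoint? : ∀ {n} (π : Permutation′ n) (i : Fin n) → Dec (IsBackPoint π i)
isBackPoint? π i = (π ⟨$⟩ʳ i <? i) ×-dec ¬? (isCycleMin? π (π ⟨$⟩ʳ i))

backPoints : ∀ {n} → Permutation′ n → ℕ
backPoints π = length (filter (isBackPoint? π) (allFinL _))

-- α⁻¹ ζ_n  (right-to-left composition: first ζ, then α⁻¹)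
α⁻¹ζ : ∀ {n} → Permutation′ (suc n) → Permutation′ (suc n)
α⁻¹ζ {n} α = ζ n ∘ₚ flip α

-- 2 g(α), from the defining relation  n + 1 - 2 g(α) = z(α) + z(α⁻¹ ζ_n)
-- (here the size of the permutation is suc n).
twoGenus : ∀ {n} → Permutation′ (suc n) → ℤ
twoGenus {n} α = + (suc n Data.Nat.+ 1) - + (z α Data.Nat.+ z (α⁻¹ζ α))

-- Call i a weak anti-excedance of π when π(i) ≤ i. If π(i) is the least element of its
-- cycle then π(i) ≤ i; this happens for exactly one i per cycle, and otherwise π(i) ≤ i
-- means precisely that i is a back point. Hence  wae(π) = backPoints(π) + z(π).
-- For β = α⁻¹ζ, substituting i = ζ⁻¹(α(j)) turns β(i) ≤ i into j ≤ α(j) − 1 (mod n);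
-- exactly one of α(j) ≤ j and j ≤ α(j) − 1 holds, except for α(j) = 1 where both do.
-- So wae(α) + wae(β) = n + 1, and the genus formula gives the theorem.
module Submission where

open import Defs
open import Data.Nat using (ℕ; suc; _+_)
open import Data.Integer using (+_)
open import Data.Fin.Permutation using (Permutation′)
open import Relation.Binary.PropositionalEquality using (_≡_)

open import Data.Nat as ℕ using (zero; _*_; z≤n; s≤s)
import Data.Nat.Properties as ℕP
open import Data.Fin as Fin using (Fin; zero; suc; toℕ; fromℕ; inject₁)
import Data.Fin.Properties as FinP
open import Data.Fin.Permutation using (_⟨$⟩ʳ_; _⟨$⟩ˡ_; inverseˡ; inverseʳ; _∘ₚ_; flip)
open import Data.List using (List; []; _∷_; filter; length; map)
import Data.List.Relation.Unary.All as All
open import Data.List.Membership.Propositional.Properties using (∈-upTo⁺)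
open import Data.Product using (_×_; _,_; ∃-syntax)
open import Data.Bool using (true; false)
open import Data.Empty using (⊥-elim)
open import Function.Bundles using (Injection)
open import Function.Properties.Inverse using (↔⇒↣)
open import Relation.Nullary using (Dec; yes; no; does)
open import Relation.Nullary.Decidable using (_×-dec_; ¬?)
open import Relation.Unary using (Decidable)
open import Relation.Binary.PropositionalEquality
  using (refl; sym; trans; cong; cong₂; subst; module ≡-Reasoning)
open import Algebra.Properties.CommutativeMonoid.Sum ℕP.+-0-commutativeMonoid
  using (sum-syntax; sum-cong-≗; ∑-distrib-+; ∑-permute; sum-replicate-zero)
import Data.Integer as ℤ
import Data.Integer.Properties as ℤP
open import Algebra.Properties.CommutativeSemigroup ℕP.+-commutativeSemigroup
  using (interchange)

indicator : ∀ {a} {A : Set a} → Dec A → ℕ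
indicator (yes _) = 1
indicator (no _) = 0

length-filter-map : ∀ {A B : Set} {P : B → Set} (P? : Decidable P) (f : A → B) (xs : List A) →
  length (filter P? (map f xs)) ≡ length (filter (λ x → P? (f x)) xs)
length-filter-map P? f [] = refl
length-filter-map P? f (x ∷ xs) with does (P? (f x))
... | true = cong suc (length-filter-map P? f xs)
... | false = length-filter-map P? f xs

length-filter-allFinL : ∀ n {P : Fin n → Set} (P? : Decidable P) →
  length (filter P? (allFinL n)) ≡ ∑[ i < n ] indicator (P? i)
length-filter-allFinL zero P? = refl
length-filter-allFinL (suc n) P? with P? zero
... | yes _ = cong suc (trans (length-filter-map P? suc (allFinL n)) (length-filter-allFinL n _))
... | no _ = trans (length-filter-map P? suc (allFinL n)) (length-filter-allFinL n _)

∑-const : ∀ n c → ∑[ i < n ] c ≡ n * c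
∑-const zero c = refl
∑-const (suc n) c = cong (_+_ c) (∑-const n c)

∑-indicator-≡zero : ∀ n → ∑[ j < suc n ] indicator (j FinP.≟ zero) ≡ 1
∑-indicator-≡zero n = cong suc (trans (sum-cong-≗ suc≢zero) (sum-replicate-zero n))
  where
    suc≢zero : ∀ (j : Fin n) → indicator (suc j FinP.≟ zero) ≡ 0
    suc≢zero j with suc j FinP.≟ zero
    ... | no _ = refl

module Orbits {n : ℕ} (π : Permutation′ n) where

  iter-+ : ∀ a b x → iter π (a + b) x ≡ iter π a (iter π b x)
  iter-+ zero b x = refl
  iter-+ (suc a) b x = cong (π ⟨$⟩ʳ_) (iter-+ a b x)

  iter-injective : ∀ k {x y} → iter π k x ≡ iter π k y → x ≡ y
  iter-injective zero e = e
  iter-injective (suc k) e = iter-injective k (Injection.injective (↔⇒↣ π) e)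

  iter-fixed : ∀ {x} → π ⟨$⟩ʳ x ≡ x → ∀ k → iter π k x ≡ x
  iter-fixed e zero = refl
  iter-fixed e (suc k) = trans (cong (π ⟨$⟩ʳ_) (iter-fixed e k)) e

  fixed⇒isCycleMin : ∀ {x} → π ⟨$⟩ʳ x ≡ x → IsCycleMin π x
  fixed⇒isCycleMin e = All.tabulate (λ {k} _ → FinP.≤-reflexive (sym (iter-fixed e k)))

  -- Pigeonhole on x, π x, …, πⁿ x.
  iter-returns : ∀ x → ∃[ e ] e ℕ.< n × iter π (suc e) x ≡ x
  iter-returns x with FinP.pigeonhole (ℕP.n<1+n n) (λ t → iter π (toℕ t) x)
  ... | i , j , i<j , same = e , e<n , sym (iter-injective (toℕ i) returns)
    where
      e = toℕ j ℕ.∸ suc (toℕ i)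
      j≡i+1+e : toℕ j ≡ toℕ i + suc e
      j≡i+1+e = trans (sym (ℕP.m+[n∸m]≡n i<j)) (sym (ℕP.+-suc (toℕ i) e))
      returns : iter π (toℕ i) x ≡ iter π (toℕ i) (iter π (suc e) x)
      returns = trans same (trans (cong (λ k → iter π k x) j≡i+1+e) (iter-+ (toℕ i) (suc e) x))
      e<n : e ℕ.< n
      e<n = ℕP.≤-trans (s≤s (ℕP.m≤n+m e (toℕ i)))
              (subst (ℕ._≤ n) (trans j≡i+1+e (ℕP.+-suc (toℕ i) e)) (ℕP.≤-pred (FinP.toℕ<n j)))

  inverse-∈-orbit : ∀ x → ∃[ e ] e ℕ.< n × iter π e x ≡ π ⟨$⟩ˡ x
  inverse-∈-orbit x with iter-returns x
  ... | e , e<n , returns = e , e<n , trans (sym (inverseˡ π)) (cong (π ⟨$⟩ˡ_) returns)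

  isCycleMin⇒≤inverse : ∀ {x} → IsCycleMin π x → x Fin.≤ π ⟨$⟩ˡ x
  isCycleMin⇒≤inverse {x} min with inverse-∈-orbit x
  ... | e , e<n , reaches = subst (x Fin.≤_) reaches (All.lookup min (∈-upTo⁺ e<n))

  isCycleMin-image⇒≤ : ∀ i → IsCycleMin π (π ⟨$⟩ʳ i) → π ⟨$⟩ʳ i Fin.≤ i
  isCycleMin-image⇒≤ i min = subst (π ⟨$⟩ʳ i Fin.≤_) (inverseˡ π) (isCycleMin⇒≤inverse min)

weakAntiExcedances : ∀ {n} → Permutation′ n → ℕ
weakAntiExcedances {n} π = ∑[ i < n ] indicator (π ⟨$⟩ʳ i FinP.≤? i)

indicator-≤-split : ∀ {n} {a b : Fin n} {C : Set}
  (a<?b : Dec (a Fin.< b)) (a≤?b : Dec (a Fin.≤ b)) (C? : Dec C) →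
  (C → a Fin.≤ b) → (a ≡ b → C) →
  indicator a≤?b ≡ indicator (a<?b ×-dec ¬? C?) + indicator C?
indicator-≤-split _ (no a≰b) (yes c) C⇒≤ ≡⇒C = ⊥-elim (a≰b (C⇒≤ c))
indicator-≤-split (yes a<b) (no a≰b) (no _) C⇒≤ ≡⇒C = ⊥-elim (a≰b (ℕP.<⇒≤ a<b))
indicator-≤-split (no _) (no _) (no _) C⇒≤ ≡⇒C = refl
indicator-≤-split (yes _) (yes _) (yes _) C⇒≤ ≡⇒C = refl
indicator-≤-split (no _) (yes _) (yes _) C⇒≤ ≡⇒C = refl
indicator-≤-split (yes _) (yes _) (no _) C⇒≤ ≡⇒C = refl
indicator-≤-split {a = a} {b} (no a≮b) (yes a≤b) (no ¬c) C⇒≤ ≡⇒C with a FinP.≟ b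
... | yes a≡b = ⊥-elim (¬c (≡⇒C a≡b))
... | no a≢b = ⊥-elim (a≮b (FinP.≤∧≢⇒< a≤b a≢b))

weakAntiExcedances≡backPoints+z : ∀ {n} (π : Permutation′ n) →
  weakAntiExcedances π ≡ backPoints π + z π
weakAntiExcedances≡backPoints+z {n} π = begin
    ∑[ i < n ] indicator (π ⟨$⟩ʳ i FinP.≤? i)
  ≡⟨ sum-cong-≗ split ⟩
    ∑[ i < n ] (indicator (isBackPoint? π i) + indicator (isCycleMin? π (π ⟨$⟩ʳ i)))
  ≡⟨ ∑-distrib-+ {n} _ _ ⟩
    ∑[ i < n ] indicator (isBackPoint? π i) + ∑[ i < n ] indicator (isCycleMin? π (π ⟨$⟩ʳ i))
  ≡⟨ cong₂ _+_ (sym (length-filter-allFinL n (isBackPoint? π)))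
               (sym (∑-permute (λ i → indicator (isCycleMin? π i)) π)) ⟩
    backPoints π + ∑[ i < n ] indicator (isCycleMin? π i)
  ≡⟨ cong (_+_ (backPoints π)) (sym (length-filter-allFinL n (isCycleMin? π))) ⟩
    backPoints π + z π
  ∎
  where
    open ≡-Reasoning
    open Orbits π
    split : ∀ i → indicator (π ⟨$⟩ʳ i FinP.≤? i)
                ≡ indicator (isBackPoint? π i) + indicator (isCycleMin? π (π ⟨$⟩ʳ i))
    split i = indicator-≤-split (π ⟨$⟩ʳ i FinP.<? i) (π ⟨$⟩ʳ i FinP.≤? i)
                (isCycleMin? π (π ⟨$⟩ʳ i)) (isCycleMin-image⇒≤ i)
                (λ fixed → subst (IsCycleMin π) (sym fixed) (fixed⇒isCycleMin fixed))

weakAntiExcedances-α⁻¹ζ : ∀ n (α : Permutation′ (suc n)) →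
  weakAntiExcedances (α⁻¹ζ α) ≡ ∑[ j < suc n ] indicator (j FinP.≤? predMod (α ⟨$⟩ʳ j))
weakAntiExcedances-α⁻¹ζ n α = trans (∑-permute (λ i → indicator (α⁻¹ζ α ⟨$⟩ʳ i FinP.≤? i)) ρ) (sum-cong-≗ λ j →
    cong (λ i → indicator (i FinP.≤? ρ ⟨$⟩ʳ j)) (β∘ρ≡id j))
  where
    ρ : Permutation′ (suc n)
    ρ = α ∘ₚ flip (ζ n)
    β∘ρ≡id : ∀ j → α⁻¹ζ α ⟨$⟩ʳ (ρ ⟨$⟩ʳ j) ≡ j
    β∘ρ≡id j = trans (cong (α ⟨$⟩ˡ_) (inverseʳ (ζ n))) (inverseˡ α)

indicator-≤-predMod : ∀ {n} (a j : Fin (suc n)) →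
  indicator (a FinP.≤? j) + indicator (j FinP.≤? predMod a) ≡ 1 + indicator (a FinP.≟ zero)
indicator-≤-predMod {n} zero j
  with zero {n} FinP.≤? j | j FinP.≤? fromℕ n | FinP._≟_ {suc n} zero zero
... | yes _ | yes _ | yes _ = refl
... | no 0≰j | _ | _ = ⊥-elim (0≰j z≤n)
... | _ | no j≰last | _ = ⊥-elim (j≰last (FinP.≤fromℕ j))
... | _ | _ | no 0≢0 = ⊥-elim (0≢0 refl)
indicator-≤-predMod (suc k) j with suc k FinP.≤? j | j FinP.≤? inject₁ k | suc k FinP.≟ zero
... | yes k<j | yes j≤k | no _ = ⊥-elim (ℕP.<-irrefl refl
        (ℕP.≤-trans k<j (subst (toℕ j ℕ.≤_) (FinP.toℕ-inject₁ k) j≤k)))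
... | yes _ | no _ | no _ = refl
... | no _ | yes _ | no _ = refl
... | no k≮j | no j≰k | no _ = ⊥-elim (j≰k (subst (toℕ j ℕ.≤_) (sym (FinP.toℕ-inject₁ k))
        (ℕP.≤-pred (ℕP.≰⇒> k≮j))))

weakAntiExcedances-α+α⁻¹ζ : ∀ n (α : Permutation′ (suc n)) →
  weakAntiExcedances α + weakAntiExcedances (α⁻¹ζ α) ≡ suc n + 1
weakAntiExcedances-α+α⁻¹ζ n α = begin
    weakAntiExcedances α + weakAntiExcedances (α⁻¹ζ α)
  ≡⟨ cong (_+_ (weakAntiExcedances α)) (weakAntiExcedances-α⁻¹ζ n α) ⟩
    ∑[ j < suc n ] [ α ⟨$⟩ʳ j ≤ j ] + ∑[ j < suc n ] [ j ≤ α ⟨$⟩ʳ j -1]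
  ≡⟨ sym (∑-distrib-+ (λ j → [ α ⟨$⟩ʳ j ≤ j ]) (λ j → [ j ≤ α ⟨$⟩ʳ j -1])) ⟩
    ∑[ j < suc n ] ([ α ⟨$⟩ʳ j ≤ j ] + [ j ≤ α ⟨$⟩ʳ j -1])
  ≡⟨ sum-cong-≗ (λ j → indicator-≤-predMod (α ⟨$⟩ʳ j) j) ⟩
    ∑[ j < suc n ] (1 + indicator (α ⟨$⟩ʳ j FinP.≟ zero))
  ≡⟨ ∑-distrib-+ (λ _ → 1) (λ j → indicator (α ⟨$⟩ʳ j FinP.≟ zero)) ⟩
    ∑[ j < suc n ] 1 + ∑[ j < suc n ] indicator (α ⟨$⟩ʳ j FinP.≟ zero)
  ≡⟨ cong₂ _+_ (trans (∑-const (suc n) 1) (ℕP.*-identityʳ (suc n)))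
               (trans (sym (∑-permute (λ j → indicator (j FinP.≟ zero)) α)) (∑-indicator-≡zero n)) ⟩
    suc n + 1
  ∎
  where
    open ≡-Reasoning
    [_≤_] : Fin (suc n) → Fin (suc n) → ℕ
    [ a ≤ b ] = indicator (a FinP.≤? b)
    [_≤_-1] : Fin (suc n) → Fin (suc n) → ℕ
    [ a ≤ b -1] = indicator (a FinP.≤? predMod b)

+-≡⇒≡-ℤ : ∀ {x y N} → x + y ≡ N → + x ≡ + N ℤ.- + y
+-≡⇒≡-ℤ {x} {y} refl = sym (begin
    + (x + y) ℤ.- + y        ≡⟨ cong (ℤ._- + y) (ℤP.pos-+ x y) ⟩
    + x ℤ.+ + y ℤ.- + y      ≡⟨ ℤP.+-assoc (+ x) (+ y) (ℤ.- + y) ⟩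
    + x ℤ.+ (+ y ℤ.- + y)    ≡⟨ cong (ℤ._+_ (+ x)) (ℤP.+-inverseʳ (+ y)) ⟩
    + x ℤ.+ ℤ.0ℤ             ≡⟨ ℤP.+-identityʳ (+ x) ⟩
    + x                      ∎)
  where open ≡-Reasoning

lemma1p5 : (n : ℕ) (α : Permutation′ (suc n)) →
    + (backPoints α + backPoints (α⁻¹ζ α)) ≡ twoGenus α
lemma1p5 n α = +-≡⇒≡-ℤ (begin
    (backPoints α + backPoints β) + (z α + z β)
  ≡⟨ interchange (backPoints α) (backPoints β) (z α) (z β) ⟩
    (backPoints α + z α) + (backPoints β + z β)
  ≡⟨ sym (cong₂ _+_ (weakAntiExcedances≡backPoints+z α) (weakAntiExcedances≡backPoints+z β)) ⟩
    weakAntiExcedances α + weakAntiExcedances β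
  ≡⟨ weakAntiExcedances-α+α⁻¹ζ n α ⟩
    suc n + 1
  ∎)
  where
    open ≡-Reasoning
    β = α⁻¹ζ α
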